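{- Let $q\ge 1$ and $n=2q$. The number of $n\times n$ permutation matrices $P$ such that the partial transpose $P^{\Gamma_2}$ is also a permutation matrix equals $q!\,(q+1)!$.
   Context: A permutation matrix of size $n$ is an $n\times n$ $\{0,1\}$-matrix with exactly one $1$ in each row and each column. For an $n\times n$ matrix $M$ with $n=pq$, view $M$ as a $p\times p$ array of $q\times q$ blocks $\mathcal{B}_{i,j}$; the partial transpose $M^{\Gamma_p}$ is the matrix obtained by replacing each block $\mathcal{B}_{i,j}$ by its transpose $\mathcal{B}_{i,j}^T$, keeping blocks in place. Here $p=2$, so $M$ is viewed as a $2\times 2$ array of $q\times q$ blocks. -}

module Defs where

open import Data.Nat using (ℕ; _+_; _*_)
open import Data.Bool using (Bool; true; false; _∧_; if_then_else_)
open import Data.Vec using (Vec; []; _∷_; map; foldr; transpose; splitAt; _++_; zipWith; take; drop; replicate)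
open import Data.Product using (_,_; proj₁; proj₂)
open import Relation.Binary.PropositionalEquality using (_≡_)

-- An m×n {0,1}-matrix, stored row by row (true = 1, false = 0).
Matrix : ℕ → ℕ → Set
Matrix m n = Vec (Vec Bool n) m

ones : ∀ {n} → Vec Bool n → ℕ
ones = foldr _ (λ b k → if b then 1 + k else k) 0

exactlyOne : ∀ {n} → Vec Bool n → Bool
exactlyOne v with ones v
... | 1 = true
... | _ = false

allB : ∀ {n} → Vec Bool n → Bool
allB = foldr _ _∧_ true

isPermutationMatrix : ∀ {n} → Matrix n n → Bool
isPermutationMatrix M = allB (map exactlyOne M) ∧ allB (map exactlyOne (transpose M))

IsPermutationMatrix : ∀ {n} → Matrix n n → Set
IsPermutationMatrix M = isPermutationMatrix M ≡ true

-- Partial transpose Γ₂ of a (2q)×(2q) matrix viewed as a 2×2 array of q×q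
-- blocks: each block is transposed in place.
partialTranspose₂ : ∀ {A : Set} (q : ℕ) → Vec (Vec A (q + q)) (q + q) → Vec (Vec A (q + q)) (q + q)
partialTranspose₂ {A} q M =
    glue (transpose (map (take q) top)) (transpose (map (drop q) top))
 ++ glue (transpose (map (take q) bot)) (transpose (map (drop q) bot))
  where
    top = take q M
    bot = drop q M
    glue : Vec (Vec A q) q → Vec (Vec A q) q → Vec (Vec A (q + q)) q
    glue = zipWith _++_

module Submission where

-- Let P be a (2q)×(2q) matrix with q×q blocks  A B / C D.  P and its partial
-- transpose P^Γ₂ (blocks transposed in place) are both permutation matrices iff
-- eight row and column conditions on the blocks hold (BlockConditions).  They say
-- precisely that X = A + B and Y = C + D are permutation matrices and that, with
-- S marking the rows where A holds the one, A = S·X, B = (1-S)·X, C = (1-S)·Y and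
-- D = S·Y, where S takes the same value on the rows of X and of Y holding the ones
-- of a common column (Compatible).  Hence valid matrices correspond to compatible
-- triples (X , Y , S) (valid↔admissible).  Deleting the first row of Y, the column
-- j of its one and, in X, the row holding the one of column j, a compatible triple
-- of size n + 1 corresponds to j : Fin (n + 1), an element of Bool ⊎ Fin n and a
-- compatible triple of size n (step); so there are n! (n + 1)! of them (count).

open import Defs
open import Data.Nat using (ℕ; zero; suc; _+_; _*_; _≥_; _!)
open import Data.Nat.Properties using (+-comm; +-assoc; +-identityʳ; suc-injective; +-commutativeSemigroup)
open import Data.Nat.Solver using (module +-*-Solver)
open import Algebra.Properties.CommutativeSemigroup +-commutativeSemigroup using (x∙yz≈y∙xz)
open import Data.Bool using (Bool; true; false; _∧_; not; if_then_else_)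
import Data.Bool.Properties as BoolP
open import Data.Fin as Fin using (Fin; zero; suc; punchIn; _↑ˡ_; _↑ʳ_)
import Data.Fin.Properties as FinP
open import Data.Maybe using (Maybe; just; nothing; fromMaybe)
import Data.Maybe as Maybe
open import Data.Vec using (Vec; []; _∷_; head; tail; lookup; map; replicate; zipWith; transpose; _++_; take; drop; tabulate; insertAt; removeAt; _[_]≔_; _⊛_)
import Data.Vec.Properties as VecP
open import Data.Product using (Σ; ∃; _×_; _,_; proj₁; proj₂)
open import Data.Sum using (_⊎_; inj₁; inj₂)
open import Relation.Nullary using (yes; no; Irrelevant)
open import Relation.Binary.PropositionalEquality
open import Function using (_∘_)
open import Function.Bundles using (_↔_; mk↔ₛ′)
open import Function.Properties.Inverse using (↔-refl; ↔-sym; ↔-trans)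
open import Data.Product.Function.NonDependent.Propositional using (_×-↔_)
open import Data.Sum.Function.Propositional using (_⊎-↔_)
open import Axiom.UniquenessOfIdentityProofs using (module Decidable⇒UIP)

vec-ext : ∀ {A : Set} {n} {u v : Vec A n} → (∀ i → lookup u i ≡ lookup v i) → u ≡ v
vec-ext {u = u} {v} h =
  trans (sym (VecP.tabulate∘lookup u)) (trans (VecP.tabulate-cong h) (VecP.tabulate∘lookup v))

bit : Bool → ℕ
bit true  = 1
bit false = 0

ones-∷ : ∀ {n} b (v : Vec Bool n) → ones (b ∷ v) ≡ bit b + ones v
ones-∷ true  v = refl
ones-∷ false v = refl

bit-complement : ∀ s → bit s + bit (not s) ≡ 1
bit-complement true  = refl
bit-complement false = refl

bit-complement⁻¹ : ∀ s s′ → bit s + bit (not s′) ≡ 1 → s ≡ s′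
bit-complement⁻¹ true  true  _ = refl
bit-complement⁻¹ false false _ = refl

sum≡1 : ∀ {a b} → a + b ≡ 1 → (a ≡ 0 × b ≡ 1) ⊎ (a ≡ 1 × b ≡ 0)
sum≡1 {0}     e    = inj₁ (refl , e)
sum≡1 {1} {0} refl = inj₂ (refl , refl)

if-true : ∀ {A : Set} {s} {a b : A} → s ≡ true → (if s then a else b) ≡ a
if-true refl = refl

if-false : ∀ {A : Set} {s} {a b : A} → s ≡ false → (if s then a else b) ≡ b
if-false refl = refl

if-same : ∀ {A : Set} s (a : A) → (if s then a else a) ≡ a
if-same true  a = refl
if-same false a = refl

if-both : ∀ s {a b : ℕ} → a ≡ 1 → b ≡ 1 → (if s then a else b) ≡ 1
if-both true  a≡1 _   = a≡1
if-both false _   b≡1 = b≡1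

ones-++ : ∀ {m n} (u : Vec Bool m) (v : Vec Bool n) → ones (u ++ v) ≡ ones u + ones v
ones-++ []      v = refl
ones-++ (b ∷ u) v = begin
  ones (b ∷ u ++ v)         ≡⟨ ones-∷ b (u ++ v) ⟩
  bit b + ones (u ++ v)     ≡⟨ cong (bit b +_) (ones-++ u v) ⟩
  bit b + (ones u + ones v) ≡⟨ sym (+-assoc (bit b) _ _) ⟩
  bit b + ones u + ones v   ≡⟨ cong (_+ ones v) (sym (ones-∷ b u)) ⟩
  ones (b ∷ u) + ones v     ∎
  where open ≡-Reasoning

ones-update : ∀ {n} (v : Vec Bool n) i b → bit (lookup v i) + ones (v [ i ]≔ b) ≡ bit b + ones v
ones-update (x ∷ v) zero b = begin
  bit x + ones (b ∷ v)     ≡⟨ cong (bit x +_) (ones-∷ b v) ⟩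
  bit x + (bit b + ones v) ≡⟨ x∙yz≈y∙xz (bit x) (bit b) (ones v) ⟩
  bit b + (bit x + ones v) ≡⟨ cong (bit b +_) (sym (ones-∷ x v)) ⟩
  bit b + ones (x ∷ v)     ∎
  where open ≡-Reasoning
ones-update (x ∷ v) (suc i) b = begin
  bit (lookup v i) + ones (x ∷ v [ i ]≔ b)     ≡⟨ cong (bit (lookup v i) +_) (ones-∷ x (v [ i ]≔ b)) ⟩
  bit (lookup v i) + (bit x + ones (v [ i ]≔ b)) ≡⟨ x∙yz≈y∙xz (bit (lookup v i)) (bit x) (ones (v [ i ]≔ b)) ⟩
  bit x + (bit (lookup v i) + ones (v [ i ]≔ b)) ≡⟨ cong (bit x +_) (ones-update v i b) ⟩
  bit x + (bit b + ones v)                     ≡⟨ x∙yz≈y∙xz (bit x) (bit b) (ones v) ⟩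
  bit b + (bit x + ones v)                     ≡⟨ cong (bit b +_) (sym (ones-∷ x v)) ⟩
  bit b + ones (x ∷ v)                         ∎
  where open ≡-Reasoning

all-false⇒ones≡0 : ∀ {n} (v : Vec Bool n) → (∀ i → lookup v i ≡ false) → ones v ≡ 0
all-false⇒ones≡0 []          off = refl
all-false⇒ones≡0 (b ∷ v) off rewrite off zero = all-false⇒ones≡0 v (off ∘ suc)

ones≡0⇒false : ∀ {n} (v : Vec Bool n) → ones v ≡ 0 → ∀ i → lookup v i ≡ false
ones≡0⇒false (false ∷ v) e zero    = refl
ones≡0⇒false (false ∷ v) e (suc i) = ones≡0⇒false v e i
ones≡0⇒false (true  ∷ v) () i

ones-replicate : ∀ n → ones (replicate n false) ≡ 0
ones-replicate n = all-false⇒ones≡0 (replicate n false) (λ i → VecP.lookup-replicate i false)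

ones-split : ∀ {n} (S v : Vec Bool n) → ones (zipWith _∧_ S v) + ones (zipWith _∧_ (map not S) v) ≡ ones v
ones-split [] [] = refl
ones-split (true ∷ S) (b ∷ v) = begin
  ones (b ∷ zipWith _∧_ S v) + out   ≡⟨ cong (_+ out) (ones-∷ b (zipWith _∧_ S v)) ⟩
  bit b + in′ + out                  ≡⟨ +-assoc (bit b) in′ out ⟩
  bit b + (in′ + out)                ≡⟨ cong (bit b +_) (ones-split S v) ⟩
  bit b + ones v                     ≡⟨ sym (ones-∷ b v) ⟩
  ones (b ∷ v)                       ∎
  where
  open ≡-Reasoning
  in′ out : ℕ
  in′ = ones (zipWith _∧_ S v)
  out = ones (zipWith _∧_ (map not S) v)
ones-split (false ∷ S) (b ∷ v) = begin
  in′ + ones (b ∷ zipWith _∧_ (map not S) v) ≡⟨ cong (in′ +_) (ones-∷ b (zipWith _∧_ (map not S) v)) ⟩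
  in′ + (bit b + out)                        ≡⟨ x∙yz≈y∙xz in′ (bit b) out ⟩
  bit b + (in′ + out)                        ≡⟨ cong (bit b +_) (ones-split S v) ⟩
  bit b + ones v                             ≡⟨ sym (ones-∷ b v) ⟩
  ones (b ∷ v)                               ∎
  where
  open ≡-Reasoning
  in′ out : ℕ
  in′ = ones (zipWith _∧_ S v)
  out = ones (zipWith _∧_ (map not S) v)

ones-insertAt : ∀ {n} (v : Vec Bool n) j → ones (insertAt v j false) ≡ ones v
ones-insertAt v       zero    = refl
ones-insertAt (x ∷ v) (suc j) = trans (ones-∷ x (insertAt v j false)) (trans (cong (bit x +_) (ones-insertAt v j)) (sym (ones-∷ x v)))

ones-removeAt : ∀ {n} (v : Vec Bool (suc n)) j → lookup v j ≡ false → ones (removeAt v j) ≡ ones v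
ones-removeAt v j vj = begin
  ones (removeAt v j)                           ≡⟨ sym (ones-insertAt (removeAt v j) j) ⟩
  ones (insertAt (removeAt v j) j false)        ≡⟨ cong (λ b → ones (insertAt (removeAt v j) j b)) (sym vj) ⟩
  ones (insertAt (removeAt v j) j (lookup v j)) ≡⟨ cong ones (VecP.insertAt-removeAt v j) ⟩
  ones v                                        ∎
  where open ≡-Reasoning

unit : ∀ {n} → Fin n → Vec Bool n
unit {n} p = replicate n false [ p ]≔ true

unit-at : ∀ {n} (p : Fin n) → lookup (unit p) p ≡ true
unit-at {n} p = VecP.lookup∘update p (replicate n false) true

unit-off : ∀ {n} {p r : Fin n} → r ≢ p → lookup (unit p) r ≡ false
unit-off {n} {p} {r} r≢p = trans (VecP.lookup∘update′ r≢p (replicate n false) true) (VecP.lookup-replicate r false)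

unit-true : ∀ {n} {j c : Fin n} → lookup (unit j) c ≡ true → c ≡ j
unit-true {j = j} {c} e with c FinP.≟ j
... | yes c≡j = c≡j
... | no  c≢j with () ← trans (sym e) (unit-off c≢j)

ones-onlyAt : ∀ {n} (w : Vec Bool n) p → (∀ r → r ≢ p → lookup w r ≡ false) → ones w ≡ bit (lookup w p)
ones-onlyAt {n} w p off = begin
  ones w                                       ≡⟨ cong ones (vec-ext {u = w} {replicate n false [ p ]≔ lookup w p} entries) ⟩
  ones (replicate n false [ p ]≔ lookup w p)   ≡⟨ cong (λ b → bit b + ones (replicate n false [ p ]≔ lookup w p))
                                                       (sym (VecP.lookup-replicate p false)) ⟩
  bit (lookup (replicate n false) p) + ones (replicate n false [ p ]≔ lookup w p)
                                               ≡⟨ ones-update (replicate n false) p (lookup w p) ⟩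
  bit (lookup w p) + ones (replicate n false)  ≡⟨ cong (bit (lookup w p) +_) (ones-replicate n) ⟩
  bit (lookup w p) + 0                         ≡⟨ +-identityʳ _ ⟩
  bit (lookup w p)                             ∎
  where
  open ≡-Reasoning
  entries : ∀ r → lookup w r ≡ lookup (replicate n false [ p ]≔ lookup w p) r
  entries r with r FinP.≟ p
  ... | yes refl = sym (VecP.lookup∘update p (replicate n false) (lookup w p))
  ... | no r≢p   = trans (off r r≢p)
                     (sym (trans (VecP.lookup∘update′ r≢p (replicate n false) _) (VecP.lookup-replicate r false)))

ones-unit : ∀ {n} (p : Fin n) → ones (unit p) ≡ 1
ones-unit p = trans (ones-onlyAt (unit p) p (λ r → unit-off)) (cong bit (unit-at p))

one-position : ∀ {n} (v : Vec Bool n) → ones v ≡ 1 → ∃ λ p → lookup v p ≡ true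
one-position (true  ∷ v) e = zero , refl
one-position (false ∷ v) e = let p , vp = one-position v e in suc p , vp

ones≡1-off : ∀ {n} (v : Vec Bool n) {p r} → ones v ≡ 1 → lookup v p ≡ true → r ≢ p → lookup v r ≡ false
ones≡1-off v {p} {r} e vp r≢p =
  trans (sym (VecP.lookup∘update′ r≢p v false)) (ones≡0⇒false (v [ p ]≔ false) cleared r)
  where
  cleared : ones (v [ p ]≔ false) ≡ 0
  cleared = suc-injective (begin
    suc (ones (v [ p ]≔ false))              ≡⟨ cong (λ b → bit b + ones (v [ p ]≔ false)) (sym vp) ⟩
    bit (lookup v p) + ones (v [ p ]≔ false) ≡⟨ ones-update v p false ⟩
    ones v                                   ≡⟨ e ⟩
    1                                        ∎)
    where open ≡-Reasoning

ones≡1⇒unit : ∀ {n} (v : Vec Bool n) {p} → ones v ≡ 1 → lookup v p ≡ true → v ≡ unit p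
ones≡1⇒unit v {p} e vp = vec-ext entries
  where
  entries : ∀ r → lookup v r ≡ lookup (unit p) r
  entries r with r FinP.≟ p
  ... | yes refl = trans vp (sym (unit-at p))
  ... | no r≢p   = trans (ones≡1-off v e vp r≢p) (sym (unit-off r≢p))

firstOne : ∀ {n} → Vec Bool n → Maybe (Fin n)
firstOne []          = nothing
firstOne (true  ∷ v) = just zero
firstOne (false ∷ v) = Maybe.map suc (firstOne v)

firstOne-just : ∀ {n} (v : Vec Bool n) {i} → firstOne v ≡ just i → lookup v i ≡ true
firstOne-just (true  ∷ v) refl = refl
firstOne-just (false ∷ v) e with firstOne v in eq
firstOne-just (false ∷ v) refl | just i = firstOne-just v eq

firstOne-nothing : ∀ {n} (v : Vec Bool n) → firstOne v ≡ nothing → ∀ i → lookup v i ≡ false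
firstOne-nothing (false ∷ v) e with firstOne v in eq
... | nothing = λ { zero → refl ; (suc i) → firstOne-nothing v eq i }

firstOne-single : ∀ {n} (v : Vec Bool n) {p} → lookup v p ≡ true → (∀ r → r ≢ p → lookup v r ≡ false) → firstOne v ≡ just p
firstOne-single (true  ∷ v) {zero}  vp off = refl
firstOne-single (true  ∷ v) {suc p} vp off with () ← off zero (λ ())
firstOne-single (false ∷ v) {suc p} vp off =
  cong (Maybe.map suc) (firstOne-single v vp (λ r r≢p → off (suc r) (r≢p ∘ FinP.suc-injective)))

firstOne-none : ∀ {n} (v : Vec Bool n) → (∀ r → lookup v r ≡ false) → firstOne v ≡ nothing
firstOne-none []          off = refl
firstOne-none (false ∷ v) off = cong (Maybe.map suc) (firstOne-none v (off ∘ suc))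
firstOne-none (true  ∷ v) off with () ← off zero

firstOne-unit : ∀ {n} (p : Fin n) → firstOne (unit p) ≡ just p
firstOne-unit p = firstOne-single (unit p) (unit-at p) (λ r → unit-off)

col : ∀ {m n} → Fin n → Matrix m n → Vec Bool m
col k M = map (λ r → lookup r k) M

entry : ∀ {m n} → Matrix m n → Fin m → Fin n → Bool
entry M x k = lookup (lookup M x) k

lookup-col : ∀ {m n} (M : Matrix m n) k x → lookup (col k M) x ≡ entry M x k
lookup-col M k x = VecP.lookup-map x _ M

lookup-transpose : ∀ {A : Set} {m n} (M : Vec (Vec A n) m) k → lookup (transpose M) k ≡ map (λ r → lookup r k) M
lookup-transpose []      k = VecP.lookup-replicate k []
lookup-transpose {n = n} (r ∷ M) k = begin
  lookup (replicate n _∷_ ⊛ r ⊛ transpose M) k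
    ≡⟨ VecP.lookup-⊛ k (replicate n _∷_ ⊛ r) (transpose M) ⟩
  lookup (replicate n _∷_ ⊛ r) k (lookup (transpose M) k)
    ≡⟨ cong (λ f → f (lookup (transpose M) k)) (VecP.lookup-⊛ k (replicate n _∷_) r) ⟩
  lookup (replicate n _∷_) k (lookup r k) (lookup (transpose M) k)
    ≡⟨ cong (λ f → f (lookup r k) (lookup (transpose M) k)) (VecP.lookup-replicate k _∷_) ⟩
  lookup r k ∷ lookup (transpose M) k
    ≡⟨ cong (lookup r k ∷_) (lookup-transpose M k) ⟩
  lookup r k ∷ map (λ r → lookup r k) M
    ∎
  where open ≡-Reasoning

col-transpose : ∀ {m n} (M : Matrix m n) x → col x (transpose M) ≡ lookup M x
col-transpose M x = vec-ext λ k → begin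
  lookup (col x (transpose M)) k      ≡⟨ lookup-col (transpose M) x k ⟩
  lookup (lookup (transpose M) k) x   ≡⟨ cong (λ r → lookup r x) (lookup-transpose M k) ⟩
  lookup (col k M) x                  ≡⟨ lookup-col M k x ⟩
  lookup (lookup M x) k               ∎
  where open ≡-Reasoning

record IsPerm {n} (M : Matrix n n) : Set where
  field
    row-one : ∀ x → ones (lookup M x) ≡ 1
    col-one : ∀ k → ones (col k M) ≡ 1

  row-off : ∀ {x k k′} → entry M x k ≡ true → k′ ≢ k → entry M x k′ ≡ false
  row-off {x} Mxk = ones≡1-off (lookup M x) (row-one x) Mxk

  col-position : ∀ k → ∃ λ x → entry M x k ≡ true
  col-position k = let x , Mxk = one-position (col k M) (col-one k) in x , trans (sym (lookup-col M k x)) Mxk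

  col-off : ∀ {x x′ k} → entry M x k ≡ true → x′ ≢ x → entry M x′ k ≡ false
  col-off {x} {x′} {k} Mxk x′≢x =
    trans (sym (lookup-col M k x′)) (ones≡1-off (col k M) (col-one k) (trans (lookup-col M k x) Mxk) x′≢x)

open IsPerm

exactlyOne⇔ones≡1 : ∀ {n} (v : Vec Bool n) → (exactlyOne v ≡ true → ones v ≡ 1) × (ones v ≡ 1 → exactlyOne v ≡ true)
exactlyOne⇔ones≡1 v with ones v
... | 0           = (λ ()) , (λ ())
... | 1           = (λ _ → refl) , (λ _ → refl)
... | suc (suc _) = (λ ()) , (λ ())

ones≡0⇒not-exactlyOne : ∀ {n} (v : Vec Bool n) → ones v ≡ 0 → exactlyOne v ≡ false
ones≡0⇒not-exactlyOne v e with ones v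
ones≡0⇒not-exactlyOne v refl | .0 = refl

allB⇔all : ∀ {A : Set} {n} (f : A → Bool) (v : Vec A n) →
  (allB (map f v) ≡ true → ∀ i → f (lookup v i) ≡ true) × ((∀ i → f (lookup v i) ≡ true) → allB (map f v) ≡ true)
allB⇔all f []      = (λ _ ()) , (λ _ → refl)
allB⇔all f (x ∷ v) with f x in fx
... | true  = (λ { e zero → fx ; e (suc i) → proj₁ (allB⇔all f v) e i }) , (λ h → proj₂ (allB⇔all f v) (h ∘ suc))
... | false = (λ ()) , (λ h → trans (sym fx) (h zero))

∧≡true : ∀ {a b} → a ∧ b ≡ true → a ≡ true × b ≡ true
∧≡true {true} {true} _ = refl , refl

all-ones≡1 : ∀ {m n} (rows : Matrix m n) → (allB (map exactlyOne rows) ≡ true → ∀ i → ones (lookup rows i) ≡ 1) ×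
                                           ((∀ i → ones (lookup rows i) ≡ 1) → allB (map exactlyOne rows) ≡ true)
all-ones≡1 rows =
  (λ e i → proj₁ (exactlyOne⇔ones≡1 (lookup rows i)) (proj₁ (allB⇔all exactlyOne rows) e i)) ,
  (λ h → proj₂ (allB⇔all exactlyOne rows) (λ i → proj₂ (exactlyOne⇔ones≡1 (lookup rows i)) (h i)))

decodePerm : ∀ {n} (M : Matrix n n) → IsPermutationMatrix M → IsPerm M
decodePerm M e = let rows , cols = ∧≡true e in record
  { row-one = proj₁ (all-ones≡1 M) rows
  ; col-one = λ k → subst (λ c → ones c ≡ 1) (lookup-transpose M k) (proj₁ (all-ones≡1 (transpose M)) cols k)
  }

encodePerm : ∀ {n} (M : Matrix n n) → IsPerm M → IsPermutationMatrix M
encodePerm M p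
  rewrite proj₂ (all-ones≡1 M) (row-one p)
        = proj₂ (all-ones≡1 (transpose M)) (λ k → subst (λ c → ones c ≡ 1) (sym (lookup-transpose M k)) (col-one p k))

∀-split : ∀ {m n} (P : Fin (m + n) → Set) → (∀ x → P (x ↑ˡ n)) → (∀ y → P (m ↑ʳ y)) → ∀ i → P i
∀-split {m} {n} P left right i = subst P (FinP.join-splitAt m n i) (byHalf (Fin.splitAt m i))
  where
  byHalf : (s : Fin m ⊎ Fin n) → P (Fin.join m n s)
  byHalf (inj₁ x) = left x
  byHalf (inj₂ y) = right y

split-++ : ∀ {A : Set} {m n} (u : Vec A m) (v : Vec A n) → take m (u ++ v) ≡ u × drop m (u ++ v) ≡ v
split-++ {m = m} u v = VecP.++-injective (take m (u ++ v)) u (VecP.take++drop≡id m (u ++ v))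

ones-col-++ : ∀ {m n p} (U : Matrix m p) (V : Matrix n p) k → ones (col k (U ++ V)) ≡ ones (col k U) + ones (col k V)
ones-col-++ U V k = trans (cong ones (VecP.map-++ _ U V)) (ones-++ (col k U) (col k V))

Valid : ∀ q → Matrix (q + q) (q + q) → Set
Valid q P = IsPermutationMatrix P × IsPermutationMatrix (partialTranspose₂ q P)

-- Validity is a pair of Boolean equations, hence proof-irrelevant.
valid-irrelevant : ∀ {q} P → Irrelevant (Valid q P)
valid-irrelevant P (a , b) (a′ , b′) = cong₂ _,_ (bool-uip a a′) (bool-uip b b′)
  where
  bool-uip : {a b : Bool} → Irrelevant (a ≡ b)
  bool-uip = Decidable⇒UIP.≡-irrelevant BoolP._≟_

Triple : ℕ → Set
Triple n = Matrix n n × Matrix n n × Vec Bool n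

record Compatible {n} (t : Triple n) : Set where
  field
    perm-X : IsPerm (proj₁ t)
    perm-Y : IsPerm (proj₁ (proj₂ t))
    agree  : ∀ {x x′ k} → entry (proj₁ t) x k ≡ true → entry (proj₁ (proj₂ t)) x′ k ≡ true →
             lookup (proj₂ (proj₂ t)) x ≡ lookup (proj₂ (proj₂ t)) x′

subset-≡ : ∀ {A : Set} {P : A → Set} → (∀ a → Irrelevant (P a)) →
  ∀ {a a′ : A} {p : P a} {p′ : P a′} → a ≡ a′ → _≡_ {A = Σ A P} (a , p) (a′ , p′)
subset-≡ irr {a} refl = cong (a ,_) (irr a _ _)

restrict-↔ : ∀ {A B : Set} {P : A → Set} {Q : B → Set} →
  (∀ a → Irrelevant (P a)) → (∀ b → Irrelevant (Q b)) →
  (f : A → B) (g : B → A) → (∀ {a} → P a → Q (f a)) → (∀ {b} → Q b → P (g b)) →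
  (∀ {a} → P a → g (f a) ≡ a) → (∀ {b} → Q b → f (g b) ≡ b) → Σ A P ↔ Σ B Q
restrict-↔ P-irr Q-irr f g f-resp g-resp g∘f f∘g =
  mk↔ₛ′ (λ (a , p) → f a , f-resp p) (λ (b , q) → g b , g-resp q)
        (λ (b , q) → subset-≡ Q-irr (f∘g q)) (λ (a , p) → subset-≡ P-irr (g∘f p))

module Blocks {q : ℕ} where

  Block : Set
  Block = Matrix q q

  Quad : Set
  Quad = Block × Block × Block × Block

  glue : ∀ {k} → Vec (Vec Bool q) k → Vec (Vec Bool q) k → Matrix k (q + q)
  glue = zipWith _++_

  assemble : Quad → Matrix (q + q) (q + q)
  assemble (A , B , C , D) = glue A B ++ glue C D

  blocks : Matrix (q + q) (q + q) → Quad
  blocks P = map (take q) (take q P) , map (drop q) (take q P) , map (take q) (drop q P) , map (drop q) (drop q P)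

  transposeEach : Quad → Quad
  transposeEach (A , B , C , D) = transpose A , transpose B , transpose C , transpose D

  unglue : ∀ {k} (A B : Vec (Vec Bool q) k) → map (take q) (glue A B) ≡ A × map (drop q) (glue A B) ≡ B
  unglue A B = vec-ext (λ x → trans (row x (take q)) (proj₁ (split-++ (lookup A x) (lookup B x)))) ,
               vec-ext (λ x → trans (row x (drop q)) (proj₂ (split-++ (lookup A x) (lookup B x))))
    where
    row : ∀ {A′ : Set} x (f : Vec Bool (q + q) → A′) → lookup (map f (glue A B)) x ≡ f (lookup A x ++ lookup B x)
    row x f = trans (VecP.lookup-map x f (glue A B)) (cong f (VecP.lookup-zipWith _++_ x A B))

  blocks-assemble : ∀ Q → blocks (assemble Q) ≡ Q
  blocks-assemble (A , B , C , D)
    rewrite proj₁ (split-++ (glue A B) (glue C D)) | proj₂ (split-++ (glue A B) (glue C D))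
          | proj₁ (unglue A B) | proj₂ (unglue A B) | proj₁ (unglue C D) | proj₂ (unglue C D) = refl

  assemble-blocks : ∀ P → assemble (blocks P) ≡ P
  assemble-blocks P = trans (cong₂ _++_ (reglue (take q P)) (reglue (drop q P))) (VecP.take++drop≡id q P)
    where
    reglue : ∀ {k} (X : Matrix k (q + q)) → glue (map (take q) X) (map (drop q) X) ≡ X
    reglue X = vec-ext λ x → begin
      lookup (glue (map (take q) X) (map (drop q) X)) x
        ≡⟨ VecP.lookup-zipWith _++_ x (map (take q) X) (map (drop q) X) ⟩
      lookup (map (take q) X) x ++ lookup (map (drop q) X) x
        ≡⟨ cong₂ _++_ (VecP.lookup-map x (take q) X) (VecP.lookup-map x (drop q) X) ⟩
      take q (lookup X x) ++ drop q (lookup X x)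
        ≡⟨ VecP.take++drop≡id q (lookup X x) ⟩
      lookup X x
        ∎
      where open ≡-Reasoning

  partialTranspose-assemble : ∀ Q → partialTranspose₂ q (assemble Q) ≡ assemble (transposeEach Q)
  partialTranspose-assemble Q = cong (assemble ∘ transposeEach) (blocks-assemble Q)

  RowsSum : Block → Block → Set
  RowsSum A B = ∀ x → ones (lookup A x) + ones (lookup B x) ≡ 1

  ColsSum : Block → Block → Set
  ColsSum A B = ∀ k → ones (col k A) + ones (col k B) ≡ 1

  ones-row-glue : ∀ {k} (A B : Vec (Vec Bool q) k) x → ones (lookup (glue A B) x) ≡ ones (lookup A x) + ones (lookup B x)
  ones-row-glue A B x = trans (cong ones (VecP.lookup-zipWith _++_ x A B)) (ones-++ (lookup A x) (lookup B x))

  col-glueˡ : ∀ {k} (A B : Vec (Vec Bool q) k) j → col (j ↑ˡ q) (glue A B) ≡ col j A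
  col-glueˡ A B j = vec-ext λ x → begin
    lookup (col (j ↑ˡ q) (glue A B)) x             ≡⟨ lookup-col (glue A B) (j ↑ˡ q) x ⟩
    lookup (lookup (glue A B) x) (j ↑ˡ q)          ≡⟨ cong (λ r → lookup r (j ↑ˡ q)) (VecP.lookup-zipWith _++_ x A B) ⟩
    lookup (lookup A x ++ lookup B x) (j ↑ˡ q)     ≡⟨ VecP.lookup-++ˡ (lookup A x) (lookup B x) j ⟩
    lookup (lookup A x) j                          ≡⟨ sym (lookup-col A j x) ⟩
    lookup (col j A) x                             ∎
    where open ≡-Reasoning

  col-glueʳ : ∀ {k} (A B : Vec (Vec Bool q) k) j → col (q ↑ʳ j) (glue A B) ≡ col j B
  col-glueʳ A B j = vec-ext λ x → begin
    lookup (col (q ↑ʳ j) (glue A B)) x             ≡⟨ lookup-col (glue A B) (q ↑ʳ j) x ⟩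
    lookup (lookup (glue A B) x) (q ↑ʳ j)          ≡⟨ cong (λ r → lookup r (q ↑ʳ j)) (VecP.lookup-zipWith _++_ x A B) ⟩
    lookup (lookup A x ++ lookup B x) (q ↑ʳ j)     ≡⟨ VecP.lookup-++ʳ (lookup A x) (lookup B x) j ⟩
    lookup (lookup B x) j                          ≡⟨ sym (lookup-col B j x) ⟩
    lookup (col j B) x                             ∎
    where open ≡-Reasoning

  module _ (A B C D : Block) where
    private
      P : Matrix (q + q) (q + q)
      P = assemble (A , B , C , D)

    ones-row-top : ∀ x → ones (lookup P (x ↑ˡ q)) ≡ ones (lookup A x) + ones (lookup B x)
    ones-row-top x = trans (cong ones (VecP.lookup-++ˡ (glue A B) (glue C D) x)) (ones-row-glue A B x)

    ones-row-bottom : ∀ x → ones (lookup P (q ↑ʳ x)) ≡ ones (lookup C x) + ones (lookup D x)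
    ones-row-bottom x = trans (cong ones (VecP.lookup-++ʳ (glue A B) (glue C D) x)) (ones-row-glue C D x)

    ones-col-left : ∀ k → ones (col (k ↑ˡ q) P) ≡ ones (col k A) + ones (col k C)
    ones-col-left k = trans (ones-col-++ (glue A B) (glue C D) (k ↑ˡ q))
                            (cong₂ _+_ (cong ones (col-glueˡ A B k)) (cong ones (col-glueˡ C D k)))

    ones-col-right : ∀ k → ones (col (q ↑ʳ k) P) ≡ ones (col k B) + ones (col k D)
    ones-col-right k = trans (ones-col-++ (glue A B) (glue C D) (q ↑ʳ k))
                             (cong₂ _+_ (cong ones (col-glueʳ A B k)) (cong ones (col-glueʳ C D k)))

  record BlockPerm (A B C D : Block) : Set where
    field
      rows-AB : RowsSum A B
      rows-CD : RowsSum C D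
      cols-AC : ColsSum A C
      cols-BD : ColsSum B D

  isPerm⇒blockPerm : ∀ A B C D → IsPerm (assemble (A , B , C , D)) → BlockPerm A B C D
  isPerm⇒blockPerm A B C D p = record
    { rows-AB = λ x → trans (sym (ones-row-top A B C D x)) (row-one p (x ↑ˡ q))
    ; rows-CD = λ x → trans (sym (ones-row-bottom A B C D x)) (row-one p (q ↑ʳ x))
    ; cols-AC = λ k → trans (sym (ones-col-left A B C D k)) (col-one p (k ↑ˡ q))
    ; cols-BD = λ k → trans (sym (ones-col-right A B C D k)) (col-one p (q ↑ʳ k))
    }

  blockPerm⇒isPerm : ∀ A B C D → BlockPerm A B C D → IsPerm (assemble (A , B , C , D))
  blockPerm⇒isPerm A B C D b = record
    { row-one = ∀-split (λ i → ones (lookup (assemble (A , B , C , D)) i) ≡ 1)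
                  (λ x → trans (ones-row-top A B C D x) (rows-AB x))
                  (λ x → trans (ones-row-bottom A B C D x) (rows-CD x))
    ; col-one = ∀-split (λ j → ones (col j (assemble (A , B , C , D))) ≡ 1)
                  (λ k → trans (ones-col-left A B C D k) (cols-AC k))
                  (λ k → trans (ones-col-right A B C D k) (cols-BD k))
    }
    where open BlockPerm b

  rowSum-transpose : ∀ (A B : Block) k → ones (lookup (transpose A) k) + ones (lookup (transpose B) k) ≡ ones (col k A) + ones (col k B)
  rowSum-transpose A B k = cong₂ _+_ (cong ones (lookup-transpose A k)) (cong ones (lookup-transpose B k))

  colSum-transpose : ∀ (A B : Block) x → ones (col x (transpose A)) + ones (col x (transpose B)) ≡ ones (lookup A x) + ones (lookup B x)
  colSum-transpose A B x = cong₂ _+_ (cong ones (col-transpose A x)) (cong ones (col-transpose B x))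

  -- Validity of  A B / C D  unfolds into eight conditions: four say that the matrix
  -- is a permutation matrix, four (on transposed blocks) that its partial transpose is.
  record BlockConditions (A B C D : Block) : Set where
    field
      rows-AB : RowsSum A B
      rows-CD : RowsSum C D
      cols-AC : ColsSum A C
      cols-BD : ColsSum B D
      cols-AB : ColsSum A B
      cols-CD : ColsSum C D
      rows-AC : RowsSum A C
      rows-BD : RowsSum B D

  valid⇒conditions : ∀ A B C D → Valid q (assemble (A , B , C , D)) → BlockConditions A B C D
  valid⇒conditions A B C D (p , γp) = record
    { rows-AB = BlockPerm.rows-AB P ; rows-CD = BlockPerm.rows-CD P
    ; cols-AC = BlockPerm.cols-AC P ; cols-BD = BlockPerm.cols-BD P
    ; cols-AB = λ k → trans (sym (rowSum-transpose A B k)) (BlockPerm.rows-AB Γ k)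
    ; cols-CD = λ k → trans (sym (rowSum-transpose C D k)) (BlockPerm.rows-CD Γ k)
    ; rows-AC = λ x → trans (sym (colSum-transpose A C x)) (BlockPerm.cols-AC Γ x)
    ; rows-BD = λ x → trans (sym (colSum-transpose B D x)) (BlockPerm.cols-BD Γ x)
    }
    where
    P : BlockPerm A B C D
    P = isPerm⇒blockPerm A B C D (decodePerm _ p)
    Γ : BlockPerm (transpose A) (transpose B) (transpose C) (transpose D)
    Γ = isPerm⇒blockPerm (transpose A) (transpose B) (transpose C) (transpose D)
          (decodePerm _ (subst IsPermutationMatrix (partialTranspose-assemble (A , B , C , D)) γp))

  conditions⇒valid : ∀ A B C D → BlockConditions A B C D → Valid q (assemble (A , B , C , D))
  conditions⇒valid A B C D c =
    encodePerm _ (blockPerm⇒isPerm A B C D (record { rows-AB = rows-AB ; rows-CD = rows-CD ; cols-AC = cols-AC ; cols-BD = cols-BD })) ,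
    subst IsPermutationMatrix (sym (partialTranspose-assemble (A , B , C , D)))
      (encodePerm _ (blockPerm⇒isPerm (transpose A) (transpose B) (transpose C) (transpose D) (record
        { rows-AB = λ k → trans (rowSum-transpose A B k) (cols-AB k)
        ; rows-CD = λ k → trans (rowSum-transpose C D k) (cols-CD k)
        ; cols-AC = λ x → trans (colSum-transpose A C x) (rows-AC x)
        ; cols-BD = λ x → trans (colSum-transpose B D x) (rows-BD x)
        })))
    where open BlockConditions c

  zeros : Vec Bool q
  zeros = replicate q false

  mask : Vec Bool q → Block → Block
  mask S X = zipWith (λ s r → if s then r else zeros) S X

  quad : Triple q → Quad
  quad (X , Y , S) = mask S X , mask (map not S) X , mask (map not S) Y , mask S Y

  lookup-mask : ∀ S X x → lookup (mask S X) x ≡ (if lookup S x then lookup X x else zeros)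
  lookup-mask S X x = VecP.lookup-zipWith _ x S X

  lookup-not : ∀ (S : Vec Bool q) x → lookup (map not S) x ≡ not (lookup S x)
  lookup-not S x = VecP.lookup-map x not S

  ones-rows-masked : ∀ S (U V : Block) x →
    ones (lookup (mask S U) x) + ones (lookup (mask (map not S) V) x) ≡ (if lookup S x then ones (lookup U x) else ones (lookup V x))
  ones-rows-masked S U V x
    rewrite lookup-mask S U x | lookup-mask (map not S) V x | lookup-not S x with lookup S x
  ... | true  = trans (cong (ones (lookup U x) +_) (ones-replicate q)) (+-identityʳ _)
  ... | false = cong (_+ ones (lookup V x)) (ones-replicate q)

  entry-mask : ∀ S X x k → entry (mask S X) x k ≡ lookup S x ∧ entry X x k
  entry-mask S X x k = trans (cong (λ r → lookup r k) (lookup-mask S X x)) (masked (lookup S x))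
    where
    masked : ∀ s → lookup (if s then lookup X x else zeros) k ≡ s ∧ entry X x k
    masked true  = refl
    masked false = VecP.lookup-replicate k false

  col-mask : ∀ S X k → col k (mask S X) ≡ zipWith _∧_ S (col k X)
  col-mask S X k = vec-ext λ x → begin
    lookup (col k (mask S X)) x         ≡⟨ lookup-col (mask S X) k x ⟩
    entry (mask S X) x k                ≡⟨ entry-mask S X x k ⟩
    lookup S x ∧ entry X x k            ≡⟨ cong (lookup S x ∧_) (sym (lookup-col X k x)) ⟩
    lookup S x ∧ lookup (col k X) x     ≡⟨ sym (VecP.lookup-zipWith _∧_ x S (col k X)) ⟩
    lookup (zipWith _∧_ S (col k X)) x  ∎
    where open ≡-Reasoning

  ones-cols-masked : ∀ S (X : Block) k → ones (col k (mask S X)) + ones (col k (mask (map not S) X)) ≡ ones (col k X)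
  ones-cols-masked S X k =
    trans (cong₂ _+_ (cong ones (col-mask S X k)) (cong ones (col-mask (map not S) X k))) (ones-split S (col k X))

  ones-col-mask-single : ∀ S (X : Block) {k p} → ones (col k X) ≡ 1 → entry X p k ≡ true → ones (col k (mask S X)) ≡ bit (lookup S p)
  ones-col-mask-single S X {k} {p} c1 Xpk = begin
    ones (col k (mask S X))             ≡⟨ cong ones (col-mask S X k) ⟩
    ones (zipWith _∧_ S (col k X))      ≡⟨ ones-onlyAt (zipWith _∧_ S (col k X)) p off ⟩
    bit (lookup (zipWith _∧_ S (col k X)) p) ≡⟨ cong bit (VecP.lookup-zipWith _∧_ p S (col k X)) ⟩
    bit (lookup S p ∧ lookup (col k X) p)    ≡⟨ cong (λ b → bit (lookup S p ∧ b)) Xkp ⟩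
    bit (lookup S p ∧ true)             ≡⟨ cong bit (BoolP.∧-identityʳ (lookup S p)) ⟩
    bit (lookup S p)                    ∎
    where
    open ≡-Reasoning
    Xkp : lookup (col k X) p ≡ true
    Xkp = trans (lookup-col X k p) Xpk
    off : ∀ r → r ≢ p → lookup (zipWith _∧_ S (col k X)) r ≡ false
    off r r≢p = trans (VecP.lookup-zipWith _∧_ r S (col k X))
                  (trans (cong (lookup S r ∧_) (ones≡1-off (col k X) c1 Xkp r≢p)) (BoolP.∧-zeroʳ (lookup S r)))

  ones-cols-mixed : ∀ S (U V : Block) {k p p′} → ones (col k U) ≡ 1 → ones (col k V) ≡ 1 →
    entry U p k ≡ true → entry V p′ k ≡ true →
    ones (col k (mask S U)) + ones (col k (mask (map not S) V)) ≡ bit (lookup S p) + bit (not (lookup S p′))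
  ones-cols-mixed S U V {p′ = p′} cU cV Upk Vp′k =
    cong₂ _+_ (ones-col-mask-single S U cU Upk)
              (trans (ones-col-mask-single (map not S) V cV Vp′k) (cong bit (lookup-not S p′)))

  compatible⇒conditions : ∀ {X Y S} → Compatible (X , Y , S) →
    BlockConditions (mask S X) (mask (map not S) X) (mask (map not S) Y) (mask S Y)
  compatible⇒conditions {X} {Y} {S} c = record
    { rows-AB = λ x → trans (ones-rows-masked S X X x) (trans (if-same (lookup S x) _) (row-one perm-X x))
    ; rows-CD = λ x → trans (+-comm (ones (lookup (mask (map not S) Y) x)) _)
                        (trans (ones-rows-masked S Y Y x) (trans (if-same (lookup S x) _) (row-one perm-Y x)))
    ; cols-AC = λ k → let p , Xpk = col-position perm-X k ; p′ , Yp′k = col-position perm-Y k in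
                  trans (ones-cols-mixed S X Y (col-one perm-X k) (col-one perm-Y k) Xpk Yp′k)
                        (trans (cong (λ s → bit (lookup S p) + bit (not s)) (sym (agree Xpk Yp′k))) (bit-complement (lookup S p)))
    ; cols-BD = λ k → let p , Xpk = col-position perm-X k ; p′ , Yp′k = col-position perm-Y k in
                  trans (+-comm (ones (col k (mask (map not S) X))) _)
                        (trans (ones-cols-mixed S Y X (col-one perm-Y k) (col-one perm-X k) Yp′k Xpk)
                               (trans (cong (λ s → bit (lookup S p′) + bit (not s)) (agree Xpk Yp′k)) (bit-complement (lookup S p′))))
    ; cols-AB = λ k → trans (ones-cols-masked S X k) (col-one perm-X k)
    ; cols-CD = λ k → trans (+-comm (ones (col k (mask (map not S) Y))) _) (trans (ones-cols-masked S Y k) (col-one perm-Y k))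
    ; rows-AC = λ x → trans (ones-rows-masked S X Y x) (if-both (lookup S x) (row-one perm-X x) (row-one perm-Y x))
    ; rows-BD = λ x → trans (+-comm (ones (lookup (mask (map not S) X) x)) _)
                        (trans (ones-rows-masked S Y X x) (if-both (lookup S x) (row-one perm-Y x) (row-one perm-X x)))
    }
    where open Compatible c

  conditions⇒compatible : ∀ {X Y S} → BlockConditions (mask S X) (mask (map not S) X) (mask (map not S) Y) (mask S Y) →
    Compatible (X , Y , S)
  conditions⇒compatible {X} {Y} {S} c = record
    { perm-X = perm-X
    ; perm-Y = perm-Y
    ; agree  = λ {x} {x′} {k} Xxk Yx′k → bit-complement⁻¹ (lookup S x) (lookup S x′)
                 (trans (sym (ones-cols-mixed S X Y (col-one perm-X k) (col-one perm-Y k) Xxk Yx′k)) (cols-AC k))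
    }
    where
    open BlockConditions c
    perm-X : IsPerm X
    perm-X = record
      { row-one = λ x → trans (sym (trans (ones-rows-masked S X X x) (if-same (lookup S x) _))) (rows-AB x)
      ; col-one = λ k → trans (sym (ones-cols-masked S X k)) (cols-AB k)
      }
    perm-Y : IsPerm Y
    perm-Y = record
      { row-one = λ x → trans (sym (trans (ones-rows-masked S Y Y x) (if-same (lookup S x) _)))
                              (trans (+-comm (ones (lookup (mask S Y) x)) _) (rows-CD x))
      ; col-one = λ k → trans (sym (ones-cols-masked S Y k)) (trans (+-comm (ones (col k (mask S Y))) _) (cols-CD k))
      }

  fromQuad : Quad → Triple q
  fromQuad (A , B , C , D) =
    tabulate (λ x → if exactlyOne (lookup A x) then lookup A x else lookup B x) ,
    tabulate (λ x → if exactlyOne (lookup A x) then lookup D x else lookup C x) ,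
    map exactlyOne A

  ones≡0⇒zeros : ∀ (v : Vec Bool q) → ones v ≡ 0 → v ≡ zeros
  ones≡0⇒zeros v e = vec-ext λ i → trans (ones≡0⇒false v e i) (sym (VecP.lookup-replicate i false))

  exactlyOne-mask : ∀ S (X : Block) x → ones (lookup X x) ≡ 1 → exactlyOne (lookup (mask S X) x) ≡ lookup S x
  exactlyOne-mask S X x e rewrite lookup-mask S X x with lookup S x
  ... | true  = proj₂ (exactlyOne⇔ones≡1 (lookup X x)) e
  ... | false = ones≡0⇒not-exactlyOne zeros (ones-replicate q)

  fromQuad-quad : ∀ X Y S → (∀ x → ones (lookup X x) ≡ 1) → fromQuad (quad (X , Y , S)) ≡ (X , Y , S)
  fromQuad-quad X Y S rows = cong₂ _,_ (vec-ext rowX) (cong₂ _,_ (vec-ext rowY) (vec-ext colour))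
    where
    colour : ∀ x → lookup (map exactlyOne (mask S X)) x ≡ lookup S x
    colour x = trans (VecP.lookup-map x exactlyOne (mask S X)) (exactlyOne-mask S X x (rows x))
    rowX : ∀ x → lookup (proj₁ (fromQuad (quad (X , Y , S)))) x ≡ lookup X x
    rowX x rewrite VecP.lookup∘tabulate (λ x → if exactlyOne (lookup (mask S X) x) then lookup (mask S X) x
                                                else lookup (mask (map not S) X) x) x
                 | exactlyOne-mask S X x (rows x) | lookup-mask S X x | lookup-mask (map not S) X x | lookup-not S x
                 with lookup S x
    ... | true  = refl
    ... | false = refl
    rowY : ∀ x → lookup (proj₁ (proj₂ (fromQuad (quad (X , Y , S))))) x ≡ lookup Y x
    rowY x rewrite VecP.lookup∘tabulate (λ x → if exactlyOne (lookup (mask S X) x) then lookup (mask S Y) x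
                                                else lookup (mask (map not S) Y) x) x
                 | exactlyOne-mask S X x (rows x) | lookup-mask S Y x | lookup-mask (map not S) Y x | lookup-not S x
                 with lookup S x
    ... | true  = refl
    ... | false = refl

  row-shape : ∀ A B C D → RowsSum A B → RowsSum A C → RowsSum B D → ∀ x →
    (exactlyOne (lookup A x) ≡ true × lookup B x ≡ zeros × lookup C x ≡ zeros) ⊎
    (exactlyOne (lookup A x) ≡ false × lookup A x ≡ zeros × lookup D x ≡ zeros)
  row-shape A B C D rows-AB rows-AC rows-BD x with sum≡1 (rows-AB x)
  ... | inj₁ (a0 , b1) = inj₂ ( ones≡0⇒not-exactlyOne (lookup A x) a0
                              , ones≡0⇒zeros (lookup A x) a0
                              , ones≡0⇒zeros (lookup D x) (suc-injective (trans (cong (_+ ones (lookup D x)) (sym b1)) (rows-BD x))) )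
  ... | inj₂ (a1 , b0) = inj₁ ( proj₂ (exactlyOne⇔ones≡1 (lookup A x)) a1
                              , ones≡0⇒zeros (lookup B x) b0
                              , ones≡0⇒zeros (lookup C x) (suc-injective (trans (cong (_+ ones (lookup C x)) (sym a1)) (rows-AC x))) )

  quad-fromQuad : ∀ A B C D → BlockConditions A B C D → quad (fromQuad (A , B , C , D)) ≡ (A , B , C , D)
  quad-fromQuad A B C D c =
    cong₂ _,_ (vec-ext rowA) (cong₂ _,_ (vec-ext rowB) (cong₂ _,_ (vec-ext rowC) (vec-ext rowD)))
    where
    open BlockConditions c
    S : Vec Bool q
    S = map exactlyOne A
    upper lower : Fin q → Vec Bool q
    upper x = if exactlyOne (lookup A x) then lookup A x else lookup B x
    lower x = if exactlyOne (lookup A x) then lookup D x else lookup C x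

    pick : ∀ f x → lookup (mask S (tabulate f)) x ≡ (if exactlyOne (lookup A x) then f x else zeros)
    pick f x rewrite lookup-mask S (tabulate f) x | VecP.lookup-map x exactlyOne A | VecP.lookup∘tabulate f x = refl

    pick-not : ∀ f x → lookup (mask (map not S) (tabulate f)) x ≡ (if not (exactlyOne (lookup A x)) then f x else zeros)
    pick-not f x rewrite lookup-mask (map not S) (tabulate f) x | lookup-not S x
                       | VecP.lookup-map x exactlyOne A | VecP.lookup∘tabulate f x = refl

    rowA : ∀ x → lookup (mask S (tabulate upper)) x ≡ lookup A x
    rowA x with row-shape A B C D rows-AB rows-AC rows-BD x
    ... | inj₁ (s , _ , _)  = trans (pick upper x) (trans (if-true s) (if-true s))
    ... | inj₂ (s , a0 , _) = trans (pick upper x) (trans (if-false s) (sym a0))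

    rowB : ∀ x → lookup (mask (map not S) (tabulate upper)) x ≡ lookup B x
    rowB x with row-shape A B C D rows-AB rows-AC rows-BD x
    ... | inj₁ (s , b0 , _) = trans (pick-not upper x) (trans (if-false (cong not s)) (sym b0))
    ... | inj₂ (s , _ , _)  = trans (pick-not upper x) (trans (if-true (cong not s)) (if-false s))

    rowC : ∀ x → lookup (mask (map not S) (tabulate lower)) x ≡ lookup C x
    rowC x with row-shape A B C D rows-AB rows-AC rows-BD x
    ... | inj₁ (s , _ , c0) = trans (pick-not lower x) (trans (if-false (cong not s)) (sym c0))
    ... | inj₂ (s , _ , _)  = trans (pick-not lower x) (trans (if-true (cong not s)) (if-false s))

    rowD : ∀ x → lookup (mask S (tabulate lower)) x ≡ lookup D x
    rowD x with row-shape A B C D rows-AB rows-AC rows-BD x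
    ... | inj₁ (s , _ , _)  = trans (pick lower x) (trans (if-true s) (if-true s))
    ... | inj₂ (s , _ , d0) = trans (pick lower x) (trans (if-false s) (sym d0))

  -- A triple is admissible when its assembled matrix is valid; this is the
  -- proof-irrelevant counterpart of compatibility.
  Admissible : Triple q → Set
  Admissible t = Valid q (assemble (quad t))

  admissible-irrelevant : ∀ t → Irrelevant (Admissible t)
  admissible-irrelevant t = valid-irrelevant {q} (assemble (quad t))

  admissible⇒compatible : ∀ {t} → Admissible t → Compatible t
  admissible⇒compatible {X , Y , S} v =
    conditions⇒compatible (valid⇒conditions (mask S X) (mask (map not S) X) (mask (map not S) Y) (mask S Y) v)

  compatible⇒admissible : ∀ {t} → Compatible t → Admissible t
  compatible⇒admissible {X , Y , S} c =
    conditions⇒valid (mask S X) (mask (map not S) X) (mask (map not S) Y) (mask S Y) (compatible⇒conditions c)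

  valid↔admissible : Σ (Matrix (q + q) (q + q)) (Valid q) ↔ Σ (Triple q) Admissible
  valid↔admissible =
    restrict-↔ (valid-irrelevant {q}) admissible-irrelevant
      (fromQuad ∘ blocks) (assemble ∘ quad)
      (λ v → subst (Valid q) (sym (reassemble v)) v) (λ a → a)
      reassemble retriple
    where
    reassemble : ∀ {P} → Valid q P → assemble (quad (fromQuad (blocks P))) ≡ P
    reassemble {P} v =
      let A , B , C , D = blocks P
      in trans (cong assemble (quad-fromQuad A B C D (valid⇒conditions A B C D v′))) (assemble-blocks P)
      where
      v′ : Valid q (assemble (blocks P))
      v′ = subst (Valid q) (sym (assemble-blocks P)) v
    retriple : ∀ {t} → Admissible t → fromQuad (blocks (assemble (quad t))) ≡ t
    retriple {X , Y , S} a = trans (cong fromQuad (blocks-assemble (quad (X , Y , S))))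
                                   (fromQuad-quad X Y S (row-one (Compatible.perm-X (admissible⇒compatible {t = X , Y , S} a))))

open Blocks using (Admissible; admissible-irrelevant; admissible⇒compatible; compatible⇒admissible; valid↔admissible)

swap₀ : ∀ {A : Set} {n} → Fin n → Vec A (suc n) → Vec A (suc n)
swap₀ i (x ∷ xs) = lookup xs i ∷ (xs [ i ]≔ x)

swapIndex : ∀ {n} → Fin n → Fin (suc n) → Fin (suc n)
swapIndex i zero = suc i
swapIndex i (suc x) with x FinP.≟ i
... | yes _ = zero
... | no  _ = suc x

lookup-swap₀ : ∀ {A : Set} {n} (i : Fin n) (v : Vec A (suc n)) x → lookup (swap₀ i v) x ≡ lookup v (swapIndex i x)
lookup-swap₀ i (y ∷ ys) zero = refl
lookup-swap₀ i (y ∷ ys) (suc x) with x FinP.≟ i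
... | yes refl = VecP.lookup∘update i ys y
... | no  x≢i  = VecP.lookup∘update′ x≢i ys y

swap₀-involutive : ∀ {A : Set} {n} (i : Fin n) (v : Vec A (suc n)) → swap₀ i (swap₀ i v) ≡ v
swap₀-involutive i (y ∷ ys) = cong₂ _∷_ (VecP.lookup∘update i ys y)
                                       (trans (VecP.[]≔-idempotent ys i) (VecP.[]≔-lookup ys i))

swap₀-equal : ∀ {A : Set} {n} (i : Fin n) (v : Vec A (suc n)) → lookup v zero ≡ lookup v (suc i) → swap₀ i v ≡ v
swap₀-equal i (y ∷ ys) y≡ysᵢ = cong₂ _∷_ (sym y≡ysᵢ) (trans (cong (ys [ i ]≔_) y≡ysᵢ) (VecP.[]≔-lookup ys i))

ones-swap₀ : ∀ {n} (i : Fin n) (v : Vec Bool (suc n)) → ones (swap₀ i v) ≡ ones v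
ones-swap₀ i (y ∷ ys) = begin
  ones (lookup ys i ∷ ys [ i ]≔ y)           ≡⟨ ones-∷ (lookup ys i) (ys [ i ]≔ y) ⟩
  bit (lookup ys i) + ones (ys [ i ]≔ y)     ≡⟨ ones-update ys i y ⟩
  bit y + ones ys                            ≡⟨ sym (ones-∷ y ys) ⟩
  ones (y ∷ ys)                              ∎
  where open ≡-Reasoning

col-swap₀ : ∀ {m n} (i : Fin m) (M : Matrix (suc m) n) k → col k (swap₀ i M) ≡ swap₀ i (col k M)
col-swap₀ i M k = vec-ext λ x → begin
  lookup (col k (swap₀ i M)) x            ≡⟨ lookup-col (swap₀ i M) k x ⟩
  lookup (lookup (swap₀ i M) x) k         ≡⟨ cong (λ r → lookup r k) (lookup-swap₀ i M x) ⟩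
  entry M (swapIndex i x) k               ≡⟨ sym (lookup-col M k (swapIndex i x)) ⟩
  lookup (col k M) (swapIndex i x)        ≡⟨ sym (lookup-swap₀ i (col k M) x) ⟩
  lookup (swap₀ i (col k M)) x            ∎
  where open ≡-Reasoning

perm-swap₀ : ∀ {n} (i : Fin n) {M : Matrix (suc n) (suc n)} → IsPerm M → IsPerm (swap₀ i M)
perm-swap₀ i {M} p = record
  { row-one = λ x → trans (cong ones (lookup-swap₀ i M x)) (row-one p (swapIndex i x))
  ; col-one = λ k → trans (cong ones (col-swap₀ i M k)) (trans (ones-swap₀ i (col k M)) (col-one p k))
  }

insertColumn : ∀ {m n} → Fin (suc n) → Matrix m n → Matrix m (suc n)
insertColumn j M = map (λ r → insertAt r j false) M

deleteColumn : ∀ {m n} → Fin (suc n) → Matrix m (suc n) → Matrix m n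
deleteColumn j M = map (λ r → removeAt r j) M

column-view : ∀ {n} (j c : Fin (suc n)) → c ≡ j ⊎ ∃ λ k → c ≡ punchIn j k
column-view j c with c FinP.≟ j
... | yes c≡j = inj₁ c≡j
... | no  c≢j = inj₂ (Fin.punchOut (c≢j ∘ sym) , sym (FinP.punchIn-punchOut (c≢j ∘ sym)))

entry-insertColumn-new : ∀ {m n} j (M : Matrix m n) x → entry (insertColumn j M) x j ≡ false
entry-insertColumn-new j M x = trans (cong (λ r → lookup r j) (VecP.lookup-map x _ M)) (VecP.insertAt-lookup (lookup M x) j false)

entry-insertColumn-old : ∀ {m n} j (M : Matrix m n) x k → entry (insertColumn j M) x (punchIn j k) ≡ entry M x k
entry-insertColumn-old j M x k =
  trans (cong (λ r → lookup r (punchIn j k)) (VecP.lookup-map x _ M)) (VecP.insertAt-punchIn (lookup M x) j false k)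

entry-insertColumn-true : ∀ {m n} j (M : Matrix m n) {x c} → entry (insertColumn j M) x c ≡ true →
  ∃ λ k → c ≡ punchIn j k × entry M x k ≡ true
entry-insertColumn-true j M {x} {c} e with column-view j c
... | inj₁ refl     with () ← trans (sym e) (entry-insertColumn-new j M x)
... | inj₂ (k , refl) = k , refl , trans (sym (entry-insertColumn-old j M x k)) e

entry-deleteColumn : ∀ {m n} j (M : Matrix m (suc n)) x k → entry (deleteColumn j M) x k ≡ entry M x (punchIn j k)
entry-deleteColumn j M x k = begin
  lookup (lookup (deleteColumn j M) x) k
    ≡⟨ cong (λ r → lookup r k) (VecP.lookup-map x _ M) ⟩
  lookup (removeAt (lookup M x) j) k
    ≡⟨ cong (lookup (removeAt (lookup M x) j)) (sym (FinP.punchOut-punchIn j)) ⟩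
  lookup (removeAt (lookup M x) j) (Fin.punchOut (FinP.punchInᵢ≢i j k ∘ sym))
    ≡⟨ VecP.removeAt-punchOut (lookup M x) (FinP.punchInᵢ≢i j k ∘ sym) ⟩
  entry M x (punchIn j k)
    ∎
  where open ≡-Reasoning

col-insertColumn-old : ∀ {m n} j (M : Matrix m n) k → col (punchIn j k) (insertColumn j M) ≡ col k M
col-insertColumn-old j M k = vec-ext λ x →
  trans (lookup-col (insertColumn j M) (punchIn j k) x) (trans (entry-insertColumn-old j M x k) (sym (lookup-col M k x)))

col-deleteColumn : ∀ {m n} j (M : Matrix m (suc n)) k → col k (deleteColumn j M) ≡ col (punchIn j k) M
col-deleteColumn j M k = vec-ext λ x →
  trans (lookup-col (deleteColumn j M) k x) (trans (entry-deleteColumn j M x k) (sym (lookup-col M (punchIn j k) x)))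

deleteColumn-insertColumn : ∀ {m n} j (M : Matrix m n) → deleteColumn j (insertColumn j M) ≡ M
deleteColumn-insertColumn j M = vec-ext λ x → begin
  lookup (deleteColumn j (insertColumn j M)) x        ≡⟨ VecP.lookup-map x _ (insertColumn j M) ⟩
  removeAt (lookup (insertColumn j M) x) j            ≡⟨ cong (λ r → removeAt r j) (VecP.lookup-map x _ M) ⟩
  removeAt (insertAt (lookup M x) j false) j          ≡⟨ VecP.removeAt-insertAt (lookup M x) j false ⟩
  lookup M x                                          ∎
  where open ≡-Reasoning

insertColumn-deleteColumn : ∀ {m n} j (M : Matrix m (suc n)) → (∀ x → entry M x j ≡ false) →
  insertColumn j (deleteColumn j M) ≡ M
insertColumn-deleteColumn j M zero-col = vec-ext λ x → begin
  lookup (insertColumn j (deleteColumn j M)) x              ≡⟨ VecP.lookup-map x _ (deleteColumn j M) ⟩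
  insertAt (lookup (deleteColumn j M) x) j false            ≡⟨ cong (λ r → insertAt r j false) (VecP.lookup-map x _ M) ⟩
  insertAt (removeAt (lookup M x) j) j false                ≡⟨ cong (insertAt (removeAt (lookup M x) j) j) (sym (zero-col x)) ⟩
  insertAt (removeAt (lookup M x) j) j (entry M x j)        ≡⟨ VecP.insertAt-removeAt (lookup M x) j ⟩
  lookup M x                                                ∎
  where open ≡-Reasoning

perm-extend : ∀ {n} j {M : Matrix n n} → IsPerm M → IsPerm (unit j ∷ insertColumn j M)
perm-extend j {M} p = record { row-one = rows ; col-one = cols }
  where
  rows : ∀ x → ones (lookup (unit j ∷ insertColumn j M) x) ≡ 1
  rows zero    = ones-unit j
  rows (suc x) = trans (cong ones (VecP.lookup-map x _ M)) (trans (ones-insertAt (lookup M x) j) (row-one p x))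
  cols : ∀ c → ones (col c (unit j ∷ insertColumn j M)) ≡ 1
  cols c with column-view j c
  ... | inj₁ refl = trans (ones-∷ (lookup (unit j) j) (col j (insertColumn j M)))
                          (cong₂ _+_ (cong bit (unit-at j))
                                     (all-false⇒ones≡0 (col j (insertColumn j M))
                                        (λ x → trans (lookup-col (insertColumn j M) j x) (entry-insertColumn-new j M x))))
  ... | inj₂ (k , refl) = trans (ones-∷ (lookup (unit j) (punchIn j k)) (col (punchIn j k) (insertColumn j M)))
                                (cong₂ _+_ (cong bit (unit-off (FinP.punchInᵢ≢i j k)))
                                           (trans (cong ones (col-insertColumn-old j M k)) (col-one p k)))

perm-reduce : ∀ {n} j {M : Matrix (suc n) (suc n)} → IsPerm M → entry M zero j ≡ true → IsPerm (deleteColumn j (tail M))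
perm-reduce j {r ∷ M} p rj = record { row-one = rows ; col-one = cols }
  where
  rows : ∀ x → ones (lookup (deleteColumn j M) x) ≡ 1
  rows x = trans (cong ones (VecP.lookup-map x _ M))
                 (trans (ones-removeAt (lookup M x) j (col-off p {zero} {suc x} rj (λ ()))) (row-one p (suc x)))
  cols : ∀ k → ones (col k (deleteColumn j M)) ≡ 1
  cols k = begin
    ones (col k (deleteColumn j M))
      ≡⟨ cong ones (col-deleteColumn j M k) ⟩
    bit false + ones (col (punchIn j k) M)
      ≡⟨ cong (λ b → bit b + ones (col (punchIn j k) M)) (sym (row-off p {zero} rj (FinP.punchInᵢ≢i j k))) ⟩
    bit (lookup r (punchIn j k)) + ones (col (punchIn j k) M)
      ≡⟨ sym (ones-∷ (lookup r (punchIn j k)) (col (punchIn j k) M)) ⟩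
    ones (col (punchIn j k) (r ∷ M))
      ≡⟨ col-one p (punchIn j k) ⟩
    1
      ∎
    where open ≡-Reasoning

reinsert : ∀ {n} j {M : Matrix (suc n) (suc n)} → IsPerm M → entry M zero j ≡ true →
  unit j ∷ insertColumn j (deleteColumn j (tail M)) ≡ M
reinsert j {r ∷ M} p rj =
  cong₂ _∷_ (sym (ones≡1⇒unit r (row-one p zero) rj)) (insertColumn-deleteColumn j M (λ x → col-off p {zero} {suc x} rj (λ ())))

extend : ∀ {n} → Fin (suc n) → Bool → Triple n → Triple (suc n)
extend j b (X , Y , S) = unit j ∷ insertColumn j X , unit j ∷ insertColumn j Y , b ∷ S

reduce : ∀ {n} → Fin (suc n) → Triple (suc n) → Triple n
reduce j (X , Y , S) = deleteColumn j (tail X) , deleteColumn j (tail Y) , tail S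

swapX : ∀ {n} → Fin n → Triple (suc n) → Triple (suc n)
swapX i (X , Y , S) = swap₀ i X , Y , S

swapX-involutive : ∀ {n} (i : Fin n) t → swapX i (swapX i t) ≡ t
swapX-involutive i (X , Y , S) = cong (_, Y , S) (swap₀-involutive i X)

reduce-extend : ∀ {n} j b (t : Triple n) → reduce j (extend j b t) ≡ t
reduce-extend j b (X , Y , S) =
  cong₂ _,_ (deleteColumn-insertColumn j X) (cong (_, S) (deleteColumn-insertColumn j Y))

compatible-extend : ∀ {n} j b {t : Triple n} → Compatible t → Compatible (extend j b t)
compatible-extend j b {X , Y , S} c = record
  { perm-X = perm-extend j (perm-X c) ; perm-Y = perm-extend j (perm-Y c) ; agree = λ {x} {x′} {k} → agree′ {x} {x′} {k} }
  where
  open Compatible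
  agree′ : ∀ {x x′ k} → entry (unit j ∷ insertColumn j X) x k ≡ true → entry (unit j ∷ insertColumn j Y) x′ k ≡ true →
           lookup (b ∷ S) x ≡ lookup (b ∷ S) x′
  agree′ {zero}  {zero}   _ _ = refl
  agree′ {zero}  {suc x′} {k} e e′ with refl ← unit-true {j = j} {k} e with () ← trans (sym e′) (entry-insertColumn-new j Y x′)
  agree′ {suc x} {zero}   {k} e e′ with refl ← unit-true {j = j} {k} e′ with () ← trans (sym e) (entry-insertColumn-new j X x)
  agree′ {suc x} {suc x′} e e′ with entry-insertColumn-true j X e
  ... | k , refl , Xxk = agree c Xxk (trans (sym (entry-insertColumn-old j Y x′ k)) e′)

compatible-reduce : ∀ {n} j {t : Triple (suc n)} → Compatible t →
  entry (proj₁ t) zero j ≡ true → entry (proj₁ (proj₂ t)) zero j ≡ true → Compatible (reduce j t)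
compatible-reduce j {x₀ ∷ X , y₀ ∷ Y , s₀ ∷ S} c x₀j y₀j = record
  { perm-X = perm-reduce j (perm-X c) x₀j
  ; perm-Y = perm-reduce j (perm-Y c) y₀j
  ; agree  = λ {x} {x′} {k} e e′ → agree c {suc x} {suc x′} {punchIn j k}
               (trans (sym (entry-deleteColumn j X x k)) e) (trans (sym (entry-deleteColumn j Y x′ k)) e′)
  }
  where open Compatible

compatible-swap : ∀ {n} (i : Fin n) {t : Triple (suc n)} → Compatible t →
  lookup (proj₂ (proj₂ t)) zero ≡ lookup (proj₂ (proj₂ t)) (suc i) → Compatible (swapX i t)
compatible-swap i {X , Y , S} c same = record
  { perm-X = perm-swap₀ i (perm-X c)
  ; perm-Y = perm-Y c
  ; agree  = λ {x} {_} {k} e e′ →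
      trans (colour-swapped x) (agree c (trans (sym (cong (λ r → lookup r k) (lookup-swap₀ i X x))) e) e′)
  }
  where
  open Compatible
  colour-swapped : ∀ x → lookup S x ≡ lookup S (swapIndex i x)
  colour-swapped x = trans (cong (λ v → lookup v x) (sym (swap₀-equal i S same))) (lookup-swap₀ i S x)

leadingColumn : ∀ {n} → Matrix (suc n) (suc n) → Fin (suc n)
leadingColumn Y = fromMaybe zero (firstOne (head Y))

-- Let j be the leading column of a compatible triple. If the one of column j of X
-- is in row 0, record its free colour; if it is in row (suc i), record i (the
-- colour of row 0 is then forced) and first swap rows 0 and (suc i) of X. In
-- both cases X and Y now start with the same row; delete it and column j.
shrinkWith : ∀ {n} → Fin (suc n) → Maybe (Fin n) → Triple (suc n) → Fin (suc n) × (Bool ⊎ Fin n) × Triple n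
shrinkWith j nothing  t@(_ , _ , S) = j , inj₁ (head S) , reduce j t
shrinkWith j (just i) t             = j , inj₂ i , reduce j (swapX i t)

shrink : ∀ {n} → Triple (suc n) → Fin (suc n) × (Bool ⊎ Fin n) × Triple n
shrink t@(X , Y , _) = shrinkWith (leadingColumn Y) (firstOne (col (leadingColumn Y) (tail X))) t

grow : ∀ {n} → Fin (suc n) × (Bool ⊎ Fin n) × Triple n → Triple (suc n)
grow (j , inj₁ b , t)             = extend j b t
grow (j , inj₂ i , t@(_ , _ , S)) = swapX i (extend j (lookup S i) t)

shrink-at : ∀ {n} (t : Triple (suc n)) {j} → leadingColumn (proj₁ (proj₂ t)) ≡ j →
  shrink t ≡ shrinkWith j (firstOne (col j (tail (proj₁ t)))) t
shrink-at t@(X , _ , _) e = cong (λ k → shrinkWith k (firstOne (col k (tail X))) t) e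

leadingColumn-unit : ∀ {n} j (Y : Matrix n (suc n)) → leadingColumn (unit j ∷ Y) ≡ j
leadingColumn-unit j Y = cong (fromMaybe zero) (firstOne-unit j)

firstOne-planted : ∀ {n} j (X : Matrix n n) i → firstOne (col j (insertColumn j X [ i ]≔ unit j)) ≡ just i
firstOne-planted j X i = firstOne-single (col j W) at off
  where
  W : Matrix _ (suc _)
  W = insertColumn j X [ i ]≔ unit j
  at : lookup (col j W) i ≡ true
  at = trans (lookup-col W j i) (trans (cong (λ r → lookup r j) (VecP.lookup∘update i (insertColumn j X) (unit j))) (unit-at j))
  off : ∀ r → r ≢ i → lookup (col j W) r ≡ false
  off r r≢i = trans (lookup-col W j r)
                    (trans (cong (λ r′ → lookup r′ j) (VecP.lookup∘update′ r≢i (insertColumn j X) (unit j)))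
                           (entry-insertColumn-new j X r))

shrink-grow : ∀ {n} (o : Fin (suc n) × (Bool ⊎ Fin n) × Triple n) → shrink (grow o) ≡ o
shrink-grow (j , inj₁ b , t@(X , Y , S)) = begin
  shrink (extend j b t)
    ≡⟨ shrink-at (extend j b t) (leadingColumn-unit j (insertColumn j Y)) ⟩
  shrinkWith j (firstOne (col j (insertColumn j X))) (extend j b t)
    ≡⟨ cong (λ m → shrinkWith j m (extend j b t)) (firstOne-none (col j (insertColumn j X)) new-column) ⟩
  j , inj₁ b , reduce j (extend j b t)
    ≡⟨ cong (λ t′ → j , inj₁ b , t′) (reduce-extend j b t) ⟩
  j , inj₁ b , t
    ∎
  where
  open ≡-Reasoning
  new-column : ∀ x → lookup (col j (insertColumn j X)) x ≡ false
  new-column x = trans (lookup-col (insertColumn j X) j x) (entry-insertColumn-new j X x)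
shrink-grow (j , inj₂ i , t@(X , Y , S)) = begin
  shrink (swapX i t₁)
    ≡⟨ shrink-at (swapX i t₁) (leadingColumn-unit j (insertColumn j Y)) ⟩
  shrinkWith j (firstOne (col j (insertColumn j X [ i ]≔ unit j))) (swapX i t₁)
    ≡⟨ cong (λ m → shrinkWith j m (swapX i t₁)) (firstOne-planted j X i) ⟩
  j , inj₂ i , reduce j (swapX i (swapX i t₁))
    ≡⟨ cong (λ t′ → j , inj₂ i , reduce j t′) (swapX-involutive i t₁) ⟩
  j , inj₂ i , reduce j t₁
    ≡⟨ cong (λ t′ → j , inj₂ i , t′) (reduce-extend j (lookup S i) t) ⟩
  j , inj₂ i , t
    ∎
  where
  open ≡-Reasoning
  t₁ : Triple (suc _)
  t₁ = extend j (lookup S i) t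

head-one : ∀ {n} b (v : Vec Bool n) → ones (b ∷ v) ≡ 1 → ones v ≡ 0 → b ≡ true
head-one true  v _ _ = refl
head-one false v e e₀ with () ← trans (sym e₀) e

leadingColumn-perm : ∀ {n} {Y : Matrix (suc n) (suc n)} {j} → IsPerm Y → entry Y zero j ≡ true → leadingColumn Y ≡ j
leadingColumn-perm {Y = y₀ ∷ Y} {j} p y₀j =
  trans (cong (λ y → leadingColumn (y ∷ Y)) (ones≡1⇒unit y₀ (row-one p zero) y₀j)) (leadingColumn-unit j Y)

extend-reduce : ∀ {n} j {t : Triple (suc n)} → Compatible t →
  entry (proj₁ t) zero j ≡ true → entry (proj₁ (proj₂ t)) zero j ≡ true →
  extend j (head (proj₂ (proj₂ t))) (reduce j t) ≡ t
extend-reduce j {X , Y , s ∷ S} c x₀j y₀j =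
  cong₂ _,_ (reinsert j (Compatible.perm-X c) x₀j) (cong (_, s ∷ S) (reinsert j (Compatible.perm-Y c) y₀j))

shrink-correct : ∀ {n} {t : Triple (suc n)} → Compatible t →
  Compatible (proj₂ (proj₂ (shrink t))) × grow (shrink t) ≡ t
shrink-correct {t = t@(x₀ ∷ X , Y , s₀ ∷ S)} c =
  subst (λ o → Compatible (proj₂ (proj₂ o)) × grow o ≡ t) (sym (shrink-at t (leadingColumn-perm (perm-Y c) y₀j)))
        (byPivot (firstOne (col j X)) refl)
  where
  open Compatible
  j : Fin _
  j = proj₁ (one-position (lookup Y zero) (row-one (perm-Y c) zero))
  y₀j : entry Y zero j ≡ true
  y₀j = proj₂ (one-position (lookup Y zero) (row-one (perm-Y c) zero))
  byPivot : ∀ m → firstOne (col j X) ≡ m → Compatible (proj₂ (proj₂ (shrinkWith j m t))) × grow (shrinkWith j m t) ≡ t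
  byPivot nothing  none = compatible-reduce j c x₀j y₀j , extend-reduce j c x₀j y₀j
    where
    x₀j : lookup x₀ j ≡ true
    x₀j = head-one (lookup x₀ j) (col j X) (col-one (perm-X c) j) (all-false⇒ones≡0 (col j X) (firstOne-nothing (col j X) none))
  byPivot (just i) found = compatible-reduce j c′ Xij y₀j , (begin
    swapX i (extend j (lookup S i) (reduce j (swapX i t)))  ≡⟨ cong (λ b → swapX i (extend j b (reduce j (swapX i t)))) colour ⟩
    swapX i (extend j s₀ (reduce j (swapX i t)))            ≡⟨ cong (swapX i) (extend-reduce j c′ Xij y₀j) ⟩
    swapX i (swapX i t)                                     ≡⟨ swapX-involutive i t ⟩
    t                                                       ∎)
    where
    open ≡-Reasoning
    Xij : entry X i j ≡ true
    Xij = trans (sym (lookup-col X j i)) (firstOne-just (col j X) found)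
    colour : lookup S i ≡ s₀
    colour = agree c {suc i} {zero} Xij y₀j
    c′ : Compatible (swapX i t)
    c′ = compatible-swap i c (sym colour)

-- Growing preserves compatibility: the swapped rows carry the same colour by construction.
grow-compatible : ∀ {n} (o : Fin (suc n) × (Bool ⊎ Fin n) × Triple n) → Compatible (proj₂ (proj₂ o)) → Compatible (grow o)
grow-compatible (j , inj₁ b , t)         c = compatible-extend j b c
grow-compatible (j , inj₂ i , (_ , _ , S)) c = compatible-swap i (compatible-extend j (lookup S i) c) refl

Σ-last : ∀ {A B C : Set} {P : C → Set} → Σ (A × B × C) (P ∘ proj₂ ∘ proj₂) ↔ (A × B × Σ C P)
Σ-last = mk↔ₛ′ (λ ((a , b , c) , p) → a , b , c , p) (λ (a , b , c , p) → (a , b , c) , p) (λ _ → refl) (λ _ → refl)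

step : ∀ {n} → Σ (Triple (suc n)) Admissible ↔ (Fin (suc n) × (Bool ⊎ Fin n) × Σ (Triple n) Admissible)
step {n} = ↔-trans
  (restrict-↔ admissible-irrelevant (λ o → admissible-irrelevant (proj₂ (proj₂ o))) shrink grow
    (λ {t} a → compatible⇒admissible (proj₁ (shrink-correct (admissible⇒compatible {suc n} {t} a))))
    (λ {o} a → compatible⇒admissible (grow-compatible o (admissible⇒compatible {n} {proj₂ (proj₂ o)} a)))
    (λ {t} a → proj₂ (shrink-correct (admissible⇒compatible {suc n} {t} a)))
    (λ {o} _ → shrink-grow o))
  Σ-last

factorial-step : ∀ n → suc n ! * suc (suc n) ! ≡ suc n * ((2 + n) * (n ! * suc n !))
factorial-step n = solve 3 (λ n a b → ((con 1 :+ n) :* a) :* ((con 2 :+ n) :* b) := (con 1 :+ n) :* ((con 2 :+ n) :* (a :* b)))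
                           refl n (n !) (suc n !)
  where open +-*-Solver

-- There are n! (n + 1)! admissible triples of size n: the empty triple is admissible,
-- and by step the count is multiplied by (n + 1) (2 + n), using Fin (2 + n) ≅ Bool ⊎ Fin n.
count : ∀ n → Fin (n ! * suc n !) ↔ Σ (Triple n) Admissible
count zero = mk↔ₛ′ (λ _ → empty , (refl , refl)) (λ _ → zero)
                   (λ { (([] , [] , []) , _) → subset-≡ admissible-irrelevant refl }) (λ { zero → refl })
  where
  empty : Triple 0
  empty = [] , [] , []
count (suc n) =
  ↔-trans (≡⇒↔ (factorial-step n))
  (↔-trans FinP.*↔×
  (↔-trans (↔-refl ×-↔ FinP.*↔×)
  (↔-trans (↔-refl ×-↔ ((↔-trans FinP.+↔⊎ (FinP.2↔Bool ⊎-↔ ↔-refl)) ×-↔ count n))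
  (↔-sym step))))
  where
  ≡⇒↔ : ∀ {a b} → a ≡ b → Fin a ↔ Fin b
  ≡⇒↔ refl = ↔-refl

-- Valid matrices of size 2q correspond to admissible triples of size q.
corollary1 : (q : ℕ) → q ≥ 1 →
    Fin ((q !) * ((suc q) !)) ↔
      Σ (Matrix (q + q) (q + q))
        (λ P → IsPermutationMatrix P × IsPermutationMatrix (partialTranspose₂ q P))
corollary1 q _ = ↔-trans (count q) (↔-sym valid↔admissible)
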